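{- Let $m\ge 2$ be an integer. A Skolem circle of order $m$ exists if and only if $m\equiv 0$ or $1 \pmod 4$.
   Context: Let $C_{2m}$ be the cycle graph with vertices $v_1,\dots,v_{2m}$ in cyclic order ($v_i$ adjacent to $v_{i+1}$, indices mod $2m$). A Skolem circle of order $m$ is a labelling of the vertices of $C_{2m}$ by labels from $\{1,2,\dots,m\}$ such that (1) each label is used exactly twice, and (2) whenever two vertices carry the same label $s$, their distance in $C_{2m}$ is exactly $s$. -}

module Defs where

open import Data.Nat using (ℕ; suc; _+_; _*_; _∸_; _⊔_; _⊓_)
open import Data.Nat.Properties using (_≟_)
open import Data.Fin using (Fin; toℕ)
open import Data.List using (length; filter; allFin)
open import Relation.Binary.PropositionalEquality using (_≡_; _≢_)
open import Data.Product using (Σ; _×_)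

absDiff : ℕ → ℕ → ℕ
absDiff i j = (i ∸ j) ⊔ (j ∸ i)

-- graph distance in the cycle C_n with vertices 0 … n-1 (vertex v_{k+1} is index k)
cycleDist : (n : ℕ) → Fin n → Fin n → ℕ
cycleDist n i j = absDiff (toℕ i) (toℕ j) ⊓ (n ∸ absDiff (toℕ i) (toℕ j))

-- a labelling of C_{2m}; label (s : Fin m) stands for the label toℕ s + 1 ∈ {1,…,m}
Labelling : ℕ → Set
Labelling m = Fin (2 * m) → Fin m

labelCount : (m : ℕ) → Labelling m → Fin m → ℕ
labelCount m f s = length (filter (λ v → toℕ (f v) ≟ toℕ s) (allFin (2 * m)))

IsSkolemCircle : (m : ℕ) → Labelling m → Set
IsSkolemCircle m f =
  ((s : Fin m) → labelCount m f s ≡ 2) ×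
  ((u v : Fin (2 * m)) → u ≢ v → f u ≡ f v → cycleDist (2 * m) u v ≡ suc (toℕ (f u)))

SkolemCircleExists : ℕ → Set
SkolemCircleExists m = Σ (Labelling m) (IsSkolemCircle m)

-- On the cycle C_{2m}, whose length is even, the distance between u and v has the parity of u + v.
-- In a Skolem circle the positions 0, …, 2m − 1 split into pairs, the pair labelled s at distance s,
-- so 0 + 1 + ⋯ + (2m − 1) ≡ 1 + 2 + ⋯ + m (mod 2), i.e. m ≡ m(m + 1)/2 (mod 2), which fails when
-- m ≡ 2, 3 (mod 4).
-- Conversely, a Skolem sequence (the same on a path of 2m vertices) is a Skolem circle, because its
-- distances are at most m. For m = 4, 5, 4j + 8, 4j + 9 we write one as a word of blocks, each block
-- holding a run of labels of one parity in decreasing or increasing order, mirrored by a twin block so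
-- that the two copies of every label lie at the right distance; counting shows that no label occurs
-- a third time.

module Submission where

open import Defs
open import Data.Nat using (ℕ; _≤_; _%_)
open import Data.Sum using (_⊎_)
open import Relation.Binary.PropositionalEquality using (_≡_)
open import Function.Bundles using (_⇔_; mk⇔)

open import Data.Bool using (true; false; if_then_else_)
open import Data.Empty using (⊥-elim)
open import Data.Fin using (Fin; toℕ; fromℕ<; #_)
open import Data.Fin.Properties using (toℕ<n; toℕ-injective; toℕ-fromℕ<)
open import Data.List using (List; []; _∷_; length; lookup; map; filter; tabulate; allFin)
open import Data.List.Membership.Propositional using (_∈_)
open import Data.List.Membership.Propositional.Properties using (∈-allFin; ∈-filter⁺)
open import Data.List.Properties using (length-tabulate)
open import Data.List.Relation.Unary.All using (All; _∷_; [])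
open import Data.List.Relation.Unary.All.Properties using (all-filter)
open import Data.List.Relation.Unary.AllPairs using (_∷_)
open import Data.List.Relation.Unary.Any using (here; there)
open import Data.List.Relation.Unary.Unique.Propositional using (Unique)
open import Data.List.Relation.Unary.Unique.Propositional.Properties using (allFin⁺; filter⁺)
open import Data.Nat using (zero; suc; _+_; _*_; _∸_; _<_; _<?_; ∣_-_∣; z≤n; s≤s; NonZero)
open import Data.Nat.DivMod using (_/_; _mod_; m<n⇒m%n≡m; [m+kn]%n≡m%n; %-distribˡ-+; m≡m%n+[m/n]*n; m%n<n)
open import Data.Nat.ListAction using (sum)
open import Data.Nat.Properties
open import Algebra.Properties.CommutativeMonoid.Sum +-0-commutativeMonoid
  using (sum-syntax; ∑-distrib-+; sum-cong-≗; sum-replicate-zero)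
  renaming (sum to ∑)
open import Data.Nat.Tactic.RingSolver using (solve-∀)
open import Data.Product using (∃-syntax; _×_; _,_; proj₁; proj₂)
open import Data.Sum using (inj₁; inj₂)
open import Relation.Nullary using (does; yes; no)
open import Relation.Binary.PropositionalEquality using (_≢_; refl; sym; trans; cong; cong₂; subst; module ≡-Reasoning)

weight : ∀ {A : Set} → (A → ℕ) → List A → ℕ
weight w xs = sum (map w xs)

weight-tabulate : ∀ {A : Set} {n} (w : A → ℕ) (h : Fin n → A) → weight w (tabulate h) ≡ ∑[ i < n ] w (h i)
weight-tabulate {n = zero} w h = refl
weight-tabulate {n = suc n} w h = cong (w (h Fin.zero) +_) (weight-tabulate w (λ i → h (Fin.suc i)))

length≡weight-1 : ∀ {A : Set} (xs : List A) → length xs ≡ weight (λ _ → 1) xs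
length≡weight-1 [] = refl
length≡weight-1 (x ∷ xs) = cong suc (length≡weight-1 xs)

∑-indicator : ∀ {n} (y : Fin n) c → ∑[ s < n ] (if does (toℕ y ≟ toℕ s) then c else 0) ≡ c
∑-indicator {suc n} Fin.zero c = trans (cong (c +_) (sum-replicate-zero n)) (+-identityʳ c)
∑-indicator {suc n} (Fin.suc y) c = ∑-indicator y c

module LabelClasses {N m : ℕ} (f : Fin N → Fin m) where

  HasLabel : Fin m → Fin N → Set
  HasLabel s v = toℕ (f v) ≡ toℕ s

  labelled : Fin m → List (Fin N) → List (Fin N)
  labelled s = filter (λ v → toℕ (f v) ≟ toℕ s)

  private
    weight-labelled-∷ : ∀ w s x xs →
      weight w (labelled s (x ∷ xs)) ≡ (if does (toℕ (f x) ≟ toℕ s) then w x else 0) + weight w (labelled s xs)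
    weight-labelled-∷ w s x xs with does (toℕ (f x) ≟ toℕ s)
    ... | true = refl
    ... | false = refl

  ∑-weight-labelled : ∀ w xs → ∑[ s < m ] weight w (labelled s xs) ≡ weight w xs
  ∑-weight-labelled w [] = sum-replicate-zero m
  ∑-weight-labelled w (x ∷ xs) = begin
    ∑[ s < m ] weight w (labelled s (x ∷ xs))
      ≡⟨ sum-cong-≗ (λ s → weight-labelled-∷ w s x xs) ⟩
    ∑[ s < m ] ((if does (toℕ (f x) ≟ toℕ s) then w x else 0) + weight w (labelled s xs))
      ≡⟨ ∑-distrib-+ (λ s → if does (toℕ (f x) ≟ toℕ s) then w x else 0) (λ s → weight w (labelled s xs)) ⟩
    ∑[ s < m ] (if does (toℕ (f x) ≟ toℕ s) then w x else 0) + ∑[ s < m ] weight w (labelled s xs)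
      ≡⟨ cong₂ _+_ (∑-indicator (f x) (w x)) (∑-weight-labelled w xs) ⟩
    w x + weight w xs ∎
    where open ≡-Reasoning

open LabelClasses

∑-labelCount : ∀ m (f : Labelling m) → ∑[ s < m ] labelCount m f s ≡ 2 * m
∑-labelCount m f = begin
  ∑[ s < m ] labelCount m f s
    ≡⟨ sum-cong-≗ (λ s → length≡weight-1 (labelled f s (allFin (2 * m)))) ⟩
  ∑[ s < m ] weight (λ _ → 1) (labelled f s (allFin (2 * m)))
    ≡⟨ ∑-weight-labelled f _ (allFin (2 * m)) ⟩
  weight (λ _ → 1) (allFin (2 * m))
    ≡⟨ length≡weight-1 (allFin (2 * m)) ⟨
  length (allFin (2 * m))
    ≡⟨ length-tabulate _ ⟩
  2 * m ∎
  where open ≡-Reasoning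

∑-≥ : ∀ {n} (c : Fin n → ℕ) k → (∀ i → k ≤ c i) → n * k ≤ ∑[ i < n ] c i
∑-≥ {zero} c k lower = z≤n
∑-≥ {suc n} c k lower = +-mono-≤ (lower Fin.zero) (∑-≥ (λ i → c (Fin.suc i)) k (λ i → lower (Fin.suc i)))

∑-tight : ∀ {n} (c : Fin n → ℕ) k → (∀ i → k ≤ c i) → ∑[ i < n ] c i ≤ n * k → ∀ i → c i ≡ k
∑-tight {suc n} c k lower upper = λ where
    Fin.zero → ≤-antisym head≤k (lower Fin.zero)
    (Fin.suc i) → ∑-tight (λ i → c (Fin.suc i)) k (λ i → lower (Fin.suc i)) rest≤ i
  where
  rest = ∑[ i < n ] c (Fin.suc i)
  rest≥ : n * k ≤ rest
  rest≥ = ∑-≥ (λ i → c (Fin.suc i)) k (λ i → lower (Fin.suc i))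
  head≤k : c Fin.zero ≤ k
  head≤k = +-cancelʳ-≤ (n * k) _ _ (≤-trans (+-monoʳ-≤ (c Fin.zero) rest≥) upper)
  rest≤ : rest ≤ n * k
  rest≤ = +-cancelˡ-≤ k _ _ (≤-trans (+-monoˡ-≤ rest (lower Fin.zero)) upper)

two≤length : ∀ {A : Set} {x y : A} {xs} → x ∈ xs → y ∈ xs → x ≢ y → 2 ≤ length xs
two≤length (here refl) (here refl) x≢y = ⊥-elim (x≢y refl)
two≤length {xs = _ ∷ _ ∷ _} _ _ _ = s≤s (s≤s z≤n)
two≤length {xs = _ ∷ []} (here refl) (there ()) _
two≤length {xs = _ ∷ []} (there ()) _ _

∈-pair : ∀ {A : Set} {x a b : A} → x ∈ a ∷ b ∷ [] → x ≡ a ⊎ x ≡ b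
∈-pair (here x≡a) = inj₁ x≡a
∈-pair (there (here x≡b)) = inj₂ x≡b

∈-length-2 : ∀ {A : Set} {x a b : A} {xs} → length xs ≡ 2 → a ∈ xs → b ∈ xs → a ≢ b → x ∈ xs → x ≡ a ⊎ x ≡ b
∈-length-2 {xs = p ∷ q ∷ []} _ a∈ b∈ a≢b x∈ with ∈-pair a∈ | ∈-pair b∈ | ∈-pair x∈
... | inj₁ refl | inj₁ refl | _ = ⊥-elim (a≢b refl)
... | inj₂ refl | inj₂ refl | _ = ⊥-elim (a≢b refl)
... | inj₁ refl | inj₂ refl | x≡p = x≡p
... | inj₂ refl | inj₁ refl | inj₁ x≡p = inj₂ x≡p
... | inj₂ refl | inj₁ refl | inj₂ x≡q = inj₁ x≡q

absDiff≡∣-∣ : ∀ a b → absDiff a b ≡ ∣ a - b ∣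
absDiff≡∣-∣ zero zero = refl
absDiff≡∣-∣ zero (suc b) = refl
absDiff≡∣-∣ (suc a) zero = refl
absDiff≡∣-∣ (suc a) (suc b) = absDiff≡∣-∣ a b

cycleDist-sym : ∀ n (u v : Fin n) → cycleDist n u v ≡ cycleDist n v u
cycleDist-sym n u v rewrite absDiff≡∣-∣ (toℕ u) (toℕ v) | absDiff≡∣-∣ (toℕ v) (toℕ u) | ∣-∣-comm (toℕ u) (toℕ v) = refl

cycleDist-offset : ∀ m (u v : Fin (2 * m)) d → toℕ v ≡ toℕ u + d → d ≤ m → cycleDist (2 * m) u v ≡ d
cycleDist-offset m u v d v≡u+d d≤m
  rewrite absDiff≡∣-∣ (toℕ u) (toℕ v) | v≡u+d | ∣m-m+n∣≡n (toℕ u) d =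
  m≤n⇒m⊓n≡m (m+n≤o⇒m≤o∸n d (≤-trans (+-mono-≤ d≤m d≤m) (≤-reflexive (cong (m +_) (sym (+-identityʳ m))))))

+-parity-∣-∣ : ∀ a b → (a + b) % 2 ≡ ∣ a - b ∣ % 2
+-parity-∣-∣ zero b = refl
+-parity-∣-∣ (suc a) zero = cong (λ x → suc x % 2) (+-identityʳ a)
+-parity-∣-∣ (suc a) (suc b) =
  trans (cong (_% 2) (shift a b)) (trans ([m+kn]%n≡m%n (a + b) 1 2) (+-parity-∣-∣ a b))
  where
  shift : ∀ a b → suc a + suc b ≡ a + b + 1 * 2
  shift = solve-∀

∸-parity : ∀ m d → d ≤ 2 * m → (2 * m ∸ d) % 2 ≡ d % 2
∸-parity m d d≤2m = begin
  (2 * m ∸ d) % 2            ≡⟨ [m+kn]%n≡m%n (2 * m ∸ d) d 2 ⟨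
  (2 * m ∸ d + d * 2) % 2    ≡⟨ cong (_% 2) (regroup (2 * m ∸ d) d) ⟩
  (2 * m ∸ d + d + d) % 2    ≡⟨ cong (λ x → (x + d) % 2) (m∸n+n≡m d≤2m) ⟩
  (2 * m + d) % 2            ≡⟨ cong (_% 2) (swap m d) ⟩
  (d + m * 2) % 2            ≡⟨ [m+kn]%n≡m%n d m 2 ⟩
  d % 2 ∎
  where
  open ≡-Reasoning
  regroup : ∀ e d → e + d * 2 ≡ e + d + d
  regroup = solve-∀
  swap : ∀ m d → 2 * m + d ≡ d + m * 2
  swap = solve-∀

cycleDist-parity : ∀ m (u v : Fin (2 * m)) → (toℕ u + toℕ v) % 2 ≡ cycleDist (2 * m) u v % 2
cycleDist-parity m u v rewrite absDiff≡∣-∣ (toℕ u) (toℕ v)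
  with ⊓-sel ∣ toℕ u - toℕ v ∣ (2 * m ∸ ∣ toℕ u - toℕ v ∣)
... | inj₁ min≡d rewrite min≡d = +-parity-∣-∣ (toℕ u) (toℕ v)
... | inj₂ min≡2m-d rewrite min≡2m-d =
  trans (+-parity-∣-∣ (toℕ u) (toℕ v)) (sym (∸-parity m _ d≤2m))
  where
  d≤2m : ∣ toℕ u - toℕ v ∣ ≤ 2 * m
  d≤2m = ≤-trans (∣m-n∣≤m⊔n (toℕ u) (toℕ v)) (⊔-lub (<⇒≤ (toℕ<n u)) (<⇒≤ (toℕ<n v)))

-- The parity argument

∑-parity-cong : ∀ {n} (c d : Fin n → ℕ) → (∀ i → c i % 2 ≡ d i % 2) → ∑[ i < n ] c i % 2 ≡ ∑[ i < n ] d i % 2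
∑-parity-cong {zero} c d c≡d = refl
∑-parity-cong {suc n} c d c≡d = begin
  (c Fin.zero + ∑[ i < n ] c (Fin.suc i)) % 2
    ≡⟨ %-distribˡ-+ (c Fin.zero) _ 2 ⟩
  (c Fin.zero % 2 + ∑[ i < n ] c (Fin.suc i) % 2) % 2
    ≡⟨ cong₂ (λ x y → (x + y) % 2) (c≡d Fin.zero) (∑-parity-cong _ _ (λ i → c≡d (Fin.suc i))) ⟩
  (d Fin.zero % 2 + ∑[ i < n ] d (Fin.suc i) % 2) % 2
    ≡⟨ %-distribˡ-+ (d Fin.zero) _ 2 ⟨
  (d Fin.zero + ∑[ i < n ] d (Fin.suc i)) % 2 ∎
  where open ≡-Reasoning

∑-suc : ∀ {n} (c : Fin n → ℕ) → ∑[ i < n ] suc (c i) ≡ n + ∑[ i < n ] c i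
∑-suc {zero} c = refl
∑-suc {suc n} c = trans (cong (suc (c Fin.zero) +_) (∑-suc (λ i → c (Fin.suc i)))) (regroup (c Fin.zero) n _)
  where
  regroup : ∀ a n s → suc a + (n + s) ≡ suc n + (a + s)
  regroup = solve-∀

gauss : ∀ n → 2 * ∑[ i < n ] toℕ i + n ≡ n * n
gauss zero = refl
gauss (suc n) = begin
  2 * ∑[ i < n ] suc (toℕ i) + suc n   ≡⟨ cong (λ x → 2 * x + suc n) (∑-suc {n} toℕ) ⟩
  2 * (n + S) + suc n                  ≡⟨ regroup n S ⟩
  (2 * S + n) + (2 * n + 1)            ≡⟨ cong (_+ (2 * n + 1)) (gauss n) ⟩
  n * n + (2 * n + 1)                  ≡⟨ square n ⟩
  suc n * suc n ∎
  where
  open ≡-Reasoning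
  S = ∑[ i < n ] toℕ i
  regroup : ∀ n S → 2 * (n + S) + suc n ≡ (2 * S + n) + (2 * n + 1)
  regroup = solve-∀
  square : ∀ n → n * n + (2 * n + 1) ≡ suc n * suc n
  square = solve-∀

odd≢even : ∀ a b → (1 + a * 2) % 2 ≢ (b * 2) % 2
odd≢even a b eq with trans (sym ([m+kn]%n≡m%n 1 a 2)) (trans eq ([m+kn]%n≡m%n 0 b 2))
... | ()

triangular-parity⇒mod4 : ∀ m T → 2 * T ≡ m * m + m → T % 2 ≡ m % 2 → m % 4 ≡ 0 ⊎ m % 4 ≡ 1
triangular-parity⇒mod4 m T 2T≡ T≡m with m % 4 | m≡m%n+[m/n]*n m 4 | m%n<n m 4
... | 0 | _ | _ = inj₁ refl
... | 1 | _ | _ = inj₂ refl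
... | 2 | m≡ | _ = ⊥-elim (odd≢even (1 + 5 * q + 4 * (q * q)) (1 + 2 * q) (begin
      (1 + (1 + 5 * q + 4 * (q * q)) * 2) % 2   ≡⟨ cong (_% 2) T≡ ⟨
      T % 2                                     ≡⟨ T≡m ⟩
      m % 2                                     ≡⟨ cong (_% 2) (trans m≡ (m-even q)) ⟩
      ((1 + 2 * q) * 2) % 2 ∎))
  where
  open ≡-Reasoning
  q = m / 4
  m-even : ∀ q → 2 + q * 4 ≡ (1 + 2 * q) * 2
  m-even = solve-∀
  double : ∀ q → (2 + q * 4) * (2 + q * 4) + (2 + q * 4) ≡ 2 * (1 + (1 + 5 * q + 4 * (q * q)) * 2)
  double = solve-∀
  T≡ : T ≡ 1 + (1 + 5 * q + 4 * (q * q)) * 2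
  T≡ = *-cancelˡ-≡ T _ 2 (trans 2T≡ (trans (cong (λ x → x * x + x) m≡) (double q)))
... | 3 | m≡ | _ = ⊥-elim (odd≢even (1 + 2 * q) ((3 + 4 * q) * (1 + q)) (begin
      (1 + (1 + 2 * q) * 2) % 2                 ≡⟨ cong (_% 2) (trans m≡ (m-odd q)) ⟨
      m % 2                                     ≡⟨ T≡m ⟨
      T % 2                                     ≡⟨ cong (_% 2) T≡ ⟩
      ((3 + 4 * q) * (1 + q) * 2) % 2 ∎))
  where
  open ≡-Reasoning
  q = m / 4
  m-odd : ∀ q → 3 + q * 4 ≡ 1 + (1 + 2 * q) * 2
  m-odd = solve-∀
  double : ∀ q → (3 + q * 4) * (3 + q * 4) + (3 + q * 4) ≡ 2 * ((3 + 4 * q) * (1 + q) * 2)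
  double = solve-∀
  T≡ : T ≡ (3 + 4 * q) * (1 + q) * 2
  T≡ = *-cancelˡ-≡ T _ 2 (trans 2T≡ (trans (cong (λ x → x * x + x) m≡) (double q)))
... | suc (suc (suc (suc _))) | _ | s≤s (s≤s (s≤s (s≤s ())))

module _ {m} (f : Labelling m) (circle : IsSkolemCircle m f) where
  private
    pair-parity : ∀ s (xs : List (Fin (2 * m))) → length xs ≡ 2 → Unique xs → All (HasLabel f s) xs →
                  weight toℕ xs % 2 ≡ suc (toℕ s) % 2
    pair-parity s (u ∷ v ∷ []) _ ((u≢v ∷ []) ∷ _) (fu≡s ∷ fv≡s ∷ []) = begin
      (toℕ u + (toℕ v + 0)) % 2   ≡⟨ cong (λ x → (toℕ u + x) % 2) (+-identityʳ (toℕ v)) ⟩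
      (toℕ u + toℕ v) % 2         ≡⟨ cycleDist-parity m u v ⟩
      cycleDist (2 * m) u v % 2   ≡⟨ cong (_% 2) (proj₂ circle u v u≢v (toℕ-injective (trans fu≡s (sym fv≡s)))) ⟩
      suc (toℕ (f u)) % 2         ≡⟨ cong (λ x → suc x % 2) fu≡s ⟩
      suc (toℕ s) % 2 ∎
      where open ≡-Reasoning

  labelled-parity : ∀ s → weight toℕ (labelled f s (allFin (2 * m))) % 2 ≡ suc (toℕ s) % 2
  labelled-parity s = pair-parity s _ (proj₁ circle s) (filter⁺ _ (allFin⁺ (2 * m))) (all-filter _ (allFin (2 * m)))

  skolemCircle⇒mod4 : m % 4 ≡ 0 ⊎ m % 4 ≡ 1
  skolemCircle⇒mod4 = triangular-parity⇒mod4 m T 2T≡m²+m (trans (sym P≡T) P≡m)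
    where
    open ≡-Reasoning
    P = ∑[ v < 2 * m ] toℕ v
    T = ∑[ s < m ] suc (toℕ s)
    P≡T : P % 2 ≡ T % 2
    P≡T = begin
      P % 2                                                      ≡⟨ cong (_% 2) (weight-tabulate {n = 2 * m} toℕ (λ v → v)) ⟨
      weight toℕ (allFin (2 * m)) % 2                            ≡⟨ cong (_% 2) (∑-weight-labelled f toℕ (allFin (2 * m))) ⟨
      ∑[ s < m ] weight toℕ (labelled f s (allFin (2 * m))) % 2  ≡⟨ ∑-parity-cong _ _ labelled-parity ⟩
      T % 2 ∎
    P+m≡2m² : P + m ≡ 2 * (m * m)
    P+m≡2m² = *-cancelˡ-≡ (P + m) _ 2 (trans (distrib P m) (trans (gauss (2 * m)) (square m)))
      where
      distrib : ∀ P m → 2 * (P + m) ≡ 2 * P + 2 * m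
      distrib = solve-∀
      square : ∀ m → 2 * m * (2 * m) ≡ 2 * (2 * (m * m))
      square = solve-∀
    P≡m : P % 2 ≡ m % 2
    P≡m = begin
      P % 2                 ≡⟨ [m+kn]%n≡m%n P m 2 ⟨
      (P + m * 2) % 2       ≡⟨ cong (_% 2) (regroup P m) ⟩
      (P + m + m) % 2       ≡⟨ cong (λ x → (x + m) % 2) P+m≡2m² ⟩
      (2 * (m * m) + m) % 2 ≡⟨ cong (_% 2) (swap m) ⟩
      (m + m * m * 2) % 2   ≡⟨ [m+kn]%n≡m%n m (m * m) 2 ⟩
      m % 2 ∎
      where
      regroup : ∀ P m → P + m * 2 ≡ P + m + m
      regroup = solve-∀
      swap : ∀ m → 2 * (m * m) + m ≡ m + m * m * 2
      swap = solve-∀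
    2T≡m²+m : 2 * T ≡ m * m + m
    2T≡m²+m = trans (cong (2 *_) (∑-suc {m} toℕ)) (trans (regroup m _) (cong (_+ m) (gauss m)))
      where
      regroup : ∀ m S → 2 * (m + S) ≡ 2 * S + m + m
      regroup = solve-∀

-- Skolem sequences are Skolem circles

-- Label t stands for t + 1, as in Defs.
SkolemPair : ℕ → (ℕ → ℕ) → ℕ → Set
SkolemPair m g t = ∃[ a ] (a + suc t < 2 * m × g a ≡ t × g (a + suc t) ≡ t)

IsSkolemSequence : ℕ → (ℕ → ℕ) → Set
IsSkolemSequence m g = ∀ t → t < m → SkolemPair m g t

module _ {m} .{{_ : NonZero m}} (g : ℕ → ℕ) (skolem : IsSkolemSequence m g) where

  circleLabelling : Labelling m
  circleLabelling v = g (toℕ v) mod m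

  private
    f = circleLabelling

    labelled-at : ∀ v s → g (toℕ v) ≡ toℕ s → HasLabel f s v
    labelled-at v s gv≡s = trans (toℕ-fromℕ< _) (trans (cong (_% m) gv≡s) (m<n⇒m%n≡m (toℕ<n s)))

    occurrences : ∀ s → ∃[ u ] ∃[ v ]
      (u ≢ v × HasLabel f s u × HasLabel f s v × cycleDist (2 * m) u v ≡ suc (toℕ s))
    occurrences s with skolem (toℕ s) (toℕ<n s)
    ... | a , b<2m , ga≡s , gb≡s =
      u , v , u≢v , labelled-at u s (trans (cong g u≡a) ga≡s) , labelled-at v s (trans (cong g v≡b) gb≡s) ,
      cycleDist-offset m u v (suc (toℕ s)) (trans v≡b (cong (_+ suc (toℕ s)) (sym u≡a))) (toℕ<n s)
      where
      u v : Fin (2 * m)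
      u = fromℕ< (≤-trans (s≤s (m≤m+n a (suc (toℕ s)))) b<2m)
      v = fromℕ< b<2m
      u≡a : toℕ u ≡ a
      u≡a = toℕ-fromℕ< _
      v≡b : toℕ v ≡ a + suc (toℕ s)
      v≡b = toℕ-fromℕ< b<2m
      u≢v : u ≢ v
      u≢v u≡v = <⇒≢ (m<m+n a (s≤s z≤n)) (trans (sym u≡a) (trans (cong toℕ u≡v) v≡b))

    member : ∀ {s} v → HasLabel f s v → v ∈ labelled f s (allFin (2 * m))
    member v fv≡s = ∈-filter⁺ _ (∈-allFin v) fv≡s

    counts : ∀ s → labelCount m f s ≡ 2
    counts = ∑-tight (labelCount m f) 2 two≤counts (≤-reflexive (trans (∑-labelCount m f) (*-comm 2 m)))
      where
      two≤counts : ∀ s → 2 ≤ labelCount m f s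
      two≤counts s with occurrences s
      ... | u , v , u≢v , fu≡s , fv≡s , _ = two≤length (member u fu≡s) (member v fv≡s) u≢v

    distances : ∀ u v → u ≢ v → f u ≡ f v → cycleDist (2 * m) u v ≡ suc (toℕ (f u))
    distances u v u≢v fu≡fv with occurrences (f u)
    ... | p , q , p≢q , fp , fq , pq≡
      with ∈-length-2 (counts (f u)) (member p fp) (member q fq) p≢q (member u refl)
         | ∈-length-2 (counts (f u)) (member p fp) (member q fq) p≢q (member v (cong toℕ (sym fu≡fv)))
    ... | inj₁ refl | inj₁ refl = ⊥-elim (u≢v refl)
    ... | inj₁ refl | inj₂ refl = pq≡
    ... | inj₂ refl | inj₁ refl = trans (cycleDist-sym (2 * m) q p) pq≡
    ... | inj₂ refl | inj₂ refl = ⊥-elim (u≢v refl)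

  skolemSequence⇒circle : SkolemCircleExists m
  skolemSequence⇒circle = circleLabelling , counts , distances

-- Skolem sequences as words of mirrored blocks

-- Block sizes and gaps are affine in a parameter j, so one word describes a whole family of
-- sequences and all spacing conditions on it hold by refl.
infix 8 _+_·j
record Affine : Set where
  constructor _+_·j
  field
    constant slope : ℕ

infixl 6 _⊕_
_⊕_ : Affine → Affine → Affine
(a + b ·j) ⊕ (c + d ·j) = (a + c) + (b + d) ·j

⟦_⟧ : Affine → ℕ → ℕ
⟦ a + b ·j ⟧ j = a + b * j

⟦⊕⟧ : ∀ x y j → ⟦ x ⊕ y ⟧ j ≡ ⟦ x ⟧ j + ⟦ y ⟧ j
⟦⊕⟧ (a + b ·j) (c + d ·j) j = regroup a b c d j
  where
  regroup : ∀ a b c d j → a + c + (b + d) * j ≡ a + b * j + (c + d * j)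
  regroup = solve-∀

-- If exactly gap positions separate opening n gap from closing n gap, the two copies of the label
-- 2y + gap lie at distance 2y + gap + 1.
data Block : Set where
  opening closing : (n gap : Affine) → Block

size : Block → Affine
size (opening n _) = n
size (closing n _) = n

entry : ℕ → Block → ℕ → ℕ
entry j (opening n gap) i = 2 * (⟦ n ⟧ j ∸ suc i) + ⟦ gap ⟧ j
entry j (closing n gap) i = 2 * i + ⟦ gap ⟧ j

label : ℕ → List Block → ℕ → ℕ
label j [] v = 0
label j (b ∷ bs) v with v <? ⟦ size b ⟧ j
... | yes _ = entry j b v
... | no _ = label j bs (v ∸ ⟦ size b ⟧ j)

blockStart : (bs : List Block) → Fin (length bs) → Affine
blockStart (b ∷ bs) Fin.zero = 0 + 0 ·j
blockStart (b ∷ bs) (Fin.suc k) = size b ⊕ blockStart bs k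

totalSize : List Block → Affine
totalSize [] = 0 + 0 ·j
totalSize (b ∷ bs) = size b ⊕ totalSize bs

label-start : ∀ j bs k i → i < ⟦ size (lookup bs k) ⟧ j → label j bs (⟦ blockStart bs k ⟧ j + i) ≡ entry j (lookup bs k) i
label-start j (b ∷ bs) Fin.zero i i<size with i <? ⟦ size b ⟧ j
... | yes _ = refl
... | no i≮size = ⊥-elim (i≮size i<size)
label-start j (b ∷ bs) (Fin.suc k) i i<size = begin
  label j (b ∷ bs) (⟦ size b ⊕ blockStart bs k ⟧ j + i)
    ≡⟨ cong (λ v → label j (b ∷ bs) (v + i)) (⟦⊕⟧ (size b) (blockStart bs k) j) ⟩
  label j (b ∷ bs) (⟦ size b ⟧ j + ⟦ blockStart bs k ⟧ j + i)
    ≡⟨ cong (label j (b ∷ bs)) (+-assoc (⟦ size b ⟧ j) _ i) ⟩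
  label j (b ∷ bs) (⟦ size b ⟧ j + (⟦ blockStart bs k ⟧ j + i))
    ≡⟨ skip (⟦ blockStart bs k ⟧ j + i) ⟩
  label j bs (⟦ blockStart bs k ⟧ j + i)
    ≡⟨ label-start j bs k i i<size ⟩
  entry j (lookup bs k) i ∎
  where
  open ≡-Reasoning
  skip : ∀ x → label j (b ∷ bs) (⟦ size b ⟧ j + x) ≡ label j bs x
  skip x with ⟦ size b ⟧ j + x <? ⟦ size b ⟧ j
  ... | yes inside = ⊥-elim (m+n≮m _ x inside)
  ... | no _ = cong (label j bs) (m+n∸m≡n (⟦ size b ⟧ j) x)

start-bound : ∀ j bs k → ⟦ blockStart bs k ⟧ j + ⟦ size (lookup bs k) ⟧ j ≤ ⟦ totalSize bs ⟧ j
start-bound j (b ∷ bs) Fin.zero = ≤-trans (m≤m+n (⟦ size b ⟧ j) _) (≤-reflexive (sym (⟦⊕⟧ (size b) (totalSize bs) j)))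
start-bound j (b ∷ bs) (Fin.suc k) = begin
  ⟦ size b ⊕ blockStart bs k ⟧ j + ⟦ size (lookup bs k) ⟧ j
    ≡⟨ cong (_+ ⟦ size (lookup bs k) ⟧ j) (⟦⊕⟧ (size b) (blockStart bs k) j) ⟩
  ⟦ size b ⟧ j + ⟦ blockStart bs k ⟧ j + ⟦ size (lookup bs k) ⟧ j
    ≡⟨ +-assoc (⟦ size b ⟧ j) _ _ ⟩
  ⟦ size b ⟧ j + (⟦ blockStart bs k ⟧ j + ⟦ size (lookup bs k) ⟧ j)
    ≤⟨ +-monoʳ-≤ (⟦ size b ⟧ j) (start-bound j bs k) ⟩
  ⟦ size b ⟧ j + ⟦ totalSize bs ⟧ j
    ≡⟨ ⟦⊕⟧ (size b) (totalSize bs) j ⟨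
  ⟦ size b ⊕ totalSize bs ⟧ j ∎
  where open ≤-Reasoning

record Mirror (bs : List Block) (n gap : Affine) : Set where
  constructor mirror
  field
    opener closer : Fin (length bs)
    opener-block : lookup bs opener ≡ opening n gap
    closer-block : lookup bs closer ≡ closing n gap
    closer-start : blockStart bs closer ≡ blockStart bs opener ⊕ n ⊕ gap

-- Mirror pairs covering the labels g, g + 2, …, h − 2.
data Chain (bs : List Block) : Affine → Affine → Set where
  [] : ∀ {g} → Chain bs g g
  _∷_ : ∀ {n g h} → Mirror bs n g → Chain bs (g ⊕ n ⊕ n) h → Chain bs g h

data Parity : ℕ → Set where
  even : ∀ u → Parity (2 * u)
  odd : ∀ u → Parity (suc (2 * u))

parity : ∀ t → Parity t
parity zero = even 0
parity (suc t) with parity t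
... | even u = odd u
... | odd u = subst Parity (cong suc (+-suc u (u + 0))) (even (suc u))

module _ (j : ℕ) (bs : List Block) {m} (total : ⟦ totalSize bs ⟧ j ≡ 2 * m) where

  mirror-pair : ∀ {n gap} → Mirror bs n gap → ∀ y → y < ⟦ n ⟧ j → SkolemPair m (label j bs) (2 * y + ⟦ gap ⟧ j)
  mirror-pair {n} {gap} (mirror o c o-block c-block c-start) y y<n = O + e , b<2m , label-a , label-b
    where
    N = ⟦ n ⟧ j
    G = ⟦ gap ⟧ j
    O = ⟦ blockStart bs o ⟧ j
    C = ⟦ blockStart bs c ⟧ j
    e = N ∸ suc y
    N≡ : suc y + e ≡ N
    N≡ = m+[n∸m]≡n y<n
    C≡ : C ≡ O + N + G
    C≡ = begin
      C                                   ≡⟨ cong (λ x → ⟦ x ⟧ j) c-start ⟩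
      ⟦ blockStart bs o ⊕ n ⊕ gap ⟧ j     ≡⟨ ⟦⊕⟧ (blockStart bs o ⊕ n) gap j ⟩
      ⟦ blockStart bs o ⊕ n ⟧ j + G       ≡⟨ cong (_+ G) (⟦⊕⟧ (blockStart bs o) n j) ⟩
      O + N + G ∎
      where open ≡-Reasoning
    b≡ : O + e + suc (2 * y + G) ≡ C + y
    b≡ = begin
      O + e + suc (2 * y + G)      ≡⟨ regroup O e y G ⟩
      O + (suc y + e) + G + y      ≡⟨ cong (λ x → O + x + G + y) N≡ ⟩
      O + N + G + y                ≡⟨ cong (_+ y) C≡ ⟨
      C + y ∎
      where
      open ≡-Reasoning
      regroup : ∀ O e y G → O + e + suc (2 * y + G) ≡ O + (suc y + e) + G + y
      regroup = solve-∀
    b<2m : O + e + suc (2 * y + G) < 2 * m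
    b<2m = begin-strict
      O + e + suc (2 * y + G)           ≡⟨ b≡ ⟩
      C + y                             <⟨ +-monoʳ-< C y<n ⟩
      C + N                             ≡⟨ cong (λ b → C + ⟦ size b ⟧ j) c-block ⟨
      C + ⟦ size (lookup bs c) ⟧ j      ≤⟨ start-bound j bs c ⟩
      ⟦ totalSize bs ⟧ j                ≡⟨ total ⟩
      2 * m ∎
      where open ≤-Reasoning
    e<size : e < ⟦ size (lookup bs o) ⟧ j
    e<size = subst (e <_) (trans N≡ (cong (λ b → ⟦ size b ⟧ j) (sym o-block))) (m<n+m e (s≤s z≤n))
    label-a : label j bs (O + e) ≡ 2 * y + G
    label-a = begin
      label j bs (O + e)                 ≡⟨ label-start j bs o e e<size ⟩
      entry j (lookup bs o) e            ≡⟨ cong (λ b → entry j b e) o-block ⟩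
      2 * (N ∸ suc e) + G                ≡⟨ cong (λ x → 2 * (x ∸ suc e) + G) N≡ ⟨
      2 * (y + e ∸ e) + G                ≡⟨ cong (λ x → 2 * x + G) (m+n∸n≡m y e) ⟩
      2 * y + G ∎
      where open ≡-Reasoning
    label-b : label j bs (O + e + suc (2 * y + G)) ≡ 2 * y + G
    label-b = begin
      label j bs (O + e + suc (2 * y + G))  ≡⟨ cong (label j bs) b≡ ⟩
      label j bs (C + y)                    ≡⟨ label-start j bs c y (subst (y <_) (cong (λ b → ⟦ size b ⟧ j) (sym c-block)) y<n) ⟩
      entry j (lookup bs c) y               ≡⟨ cong (λ b → entry j b y) c-block ⟩
      2 * y + G ∎
      where open ≡-Reasoning

  chain-pair : ∀ {g h} → Chain bs g h → ∀ y → ⟦ g ⟧ j + 2 * y < ⟦ h ⟧ j → SkolemPair m (label j bs) (⟦ g ⟧ j + 2 * y)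
  chain-pair [] y bound = ⊥-elim (m+n≮m _ _ bound)
  chain-pair {g} {h} (_∷_ {n} p ps) y bound with y <? ⟦ n ⟧ j
  ... | yes y<n = subst (SkolemPair m (label j bs)) (+-comm (2 * y) (⟦ g ⟧ j)) (mirror-pair p y y<n)
  ... | no y≮n = subst (SkolemPair m (label j bs)) (sym shift) (chain-pair ps (y ∸ N) (subst (_< ⟦ h ⟧ j) shift bound))
    where
    N = ⟦ n ⟧ j
    shift : ⟦ g ⟧ j + 2 * y ≡ ⟦ g ⊕ n ⊕ n ⟧ j + 2 * (y ∸ N)
    shift = begin
      ⟦ g ⟧ j + 2 * y                       ≡⟨ cong (λ x → ⟦ g ⟧ j + 2 * x) (m+[n∸m]≡n (≮⇒≥ y≮n)) ⟨
      ⟦ g ⟧ j + 2 * (N + (y ∸ N))           ≡⟨ regroup (⟦ g ⟧ j) N (y ∸ N) ⟩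
      ⟦ g ⟧ j + N + N + 2 * (y ∸ N)         ≡⟨ cong (λ x → x + N + 2 * (y ∸ N)) (⟦⊕⟧ g n j) ⟨
      ⟦ g ⊕ n ⟧ j + N + 2 * (y ∸ N)         ≡⟨ cong (_+ 2 * (y ∸ N)) (⟦⊕⟧ (g ⊕ n) n j) ⟨
      ⟦ g ⊕ n ⊕ n ⟧ j + 2 * (y ∸ N) ∎
      where
      open ≡-Reasoning
      regroup : ∀ G N z → G + 2 * (N + z) ≡ G + N + N + 2 * z
      regroup = solve-∀

  chains⇒skolemSequence : ∀ {E O} → Chain bs (0 + 0 ·j) E → Chain bs (1 + 0 ·j) O →
                          m ≤ ⟦ E ⟧ j → m ≤ ⟦ O ⟧ j → IsSkolemSequence m (label j bs)
  chains⇒skolemSequence evens odds m≤E m≤O t t<m with parity t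
  ... | even u = chain-pair evens u (<-≤-trans t<m m≤E)
  ... | odd u = chain-pair odds u (<-≤-trans t<m m≤O)

word⇒skolemSequence : ∀ j bs M {E O} → totalSize bs ≡ M ⊕ M → Chain bs (0 + 0 ·j) E → Chain bs (1 + 0 ·j) O →
                      ⟦ M ⟧ j ≤ ⟦ E ⟧ j → ⟦ M ⟧ j ≤ ⟦ O ⟧ j → IsSkolemSequence (⟦ M ⟧ j) (label j bs)
word⇒skolemSequence j bs M total = chains⇒skolemSequence j bs (begin
  ⟦ totalSize bs ⟧ j       ≡⟨ cong (λ x → ⟦ x ⟧ j) total ⟩
  ⟦ M ⊕ M ⟧ j              ≡⟨ ⟦⊕⟧ M M j ⟩
  ⟦ M ⟧ j + ⟦ M ⟧ j        ≡⟨ cong (⟦ M ⟧ j +_) (+-identityʳ (⟦ M ⟧ j)) ⟨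
  2 * ⟦ M ⟧ j ∎)
  where open ≡-Reasoning

word-4 : List Block
word-4 =
  opening (1 + 0 ·j) (3 + 0 ·j) ∷ opening (1 + 0 ·j) (1 + 0 ·j) ∷ opening (1 + 0 ·j) (2 + 0 ·j) ∷
  closing (1 + 0 ·j) (1 + 0 ·j) ∷ closing (1 + 0 ·j) (3 + 0 ·j) ∷ closing (1 + 0 ·j) (2 + 0 ·j) ∷
  opening (1 + 0 ·j) (0 + 0 ·j) ∷ closing (1 + 0 ·j) (0 + 0 ·j) ∷ []

skolem-4 : IsSkolemSequence 4 (label 0 word-4)
skolem-4 = word⇒skolemSequence 0 word-4 (4 + 0 ·j) refl
  (mirror (# 6) (# 7) refl refl refl ∷ mirror (# 2) (# 5) refl refl refl ∷ [])
  (mirror (# 1) (# 3) refl refl refl ∷ mirror (# 0) (# 4) refl refl refl ∷ [])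
  ≤-refl (n≤1+n 4)

word-5 : List Block
word-5 =
  opening (1 + 0 ·j) (4 + 0 ·j) ∷ opening (1 + 0 ·j) (1 + 0 ·j) ∷ opening (1 + 0 ·j) (3 + 0 ·j) ∷
  closing (1 + 0 ·j) (1 + 0 ·j) ∷ opening (1 + 0 ·j) (2 + 0 ·j) ∷ closing (1 + 0 ·j) (4 + 0 ·j) ∷
  closing (1 + 0 ·j) (3 + 0 ·j) ∷ closing (1 + 0 ·j) (2 + 0 ·j) ∷
  opening (1 + 0 ·j) (0 + 0 ·j) ∷ closing (1 + 0 ·j) (0 + 0 ·j) ∷ []

skolem-5 : IsSkolemSequence 5 (label 0 word-5)
skolem-5 = word⇒skolemSequence 0 word-5 (5 + 0 ·j) refl
  (mirror (# 8) (# 9) refl refl refl ∷ mirror (# 4) (# 7) refl refl refl ∷ mirror (# 0) (# 5) refl refl refl ∷ [])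
  (mirror (# 1) (# 3) refl refl refl ∷ mirror (# 2) (# 6) refl refl refl ∷ [])
  (n≤1+n 5) ≤-refl

word-4j+8 : List Block
word-4j+8 =
  opening (0 + 1 ·j) (6 + 2 ·j) ∷ opening (1 + 0 ·j) (4 + 2 ·j) ∷ opening (1 + 0 ·j) (0 + 0 ·j) ∷
  closing (1 + 0 ·j) (0 + 0 ·j) ∷ opening (0 + 1 ·j) (2 + 0 ·j) ∷ opening (1 + 0 ·j) (2 + 2 ·j) ∷
  opening (1 + 0 ·j) (6 + 4 ·j) ∷ closing (0 + 1 ·j) (2 + 0 ·j) ∷ closing (1 + 0 ·j) (4 + 2 ·j) ∷
  closing (0 + 1 ·j) (6 + 2 ·j) ∷ closing (1 + 0 ·j) (2 + 2 ·j) ∷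
  opening (4 + 2 ·j) (1 + 0 ·j) ∷ closing (1 + 0 ·j) (6 + 4 ·j) ∷ closing (4 + 2 ·j) (1 + 0 ·j) ∷ []

skolem-4j+8 : ∀ j → IsSkolemSequence (8 + 4 * j) (label j word-4j+8)
skolem-4j+8 j = word⇒skolemSequence j word-4j+8 (8 + 4 ·j) refl
  (mirror (# 2) (# 3) refl refl refl ∷ mirror (# 4) (# 7) refl refl refl ∷ mirror (# 5) (# 10) refl refl refl ∷
   mirror (# 1) (# 8) refl refl refl ∷ mirror (# 0) (# 9) refl refl refl ∷ mirror (# 6) (# 12) refl refl refl ∷ [])
  (mirror (# 11) (# 13) refl refl refl ∷ [])
  ≤-refl (n≤1+n _)

word-4j+9 : List Block
word-4j+9 =
  opening (2 + 1 ·j) (4 + 2 ·j) ∷ opening (1 + 0 ·j) (0 + 0 ·j) ∷ closing (1 + 0 ·j) (0 + 0 ·j) ∷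
  opening (0 + 1 ·j) (2 + 0 ·j) ∷ opening (1 + 0 ·j) (8 + 4 ·j) ∷ opening (1 + 0 ·j) (2 + 2 ·j) ∷
  closing (0 + 1 ·j) (2 + 0 ·j) ∷ closing (2 + 1 ·j) (4 + 2 ·j) ∷ closing (1 + 0 ·j) (2 + 2 ·j) ∷
  opening (4 + 2 ·j) (1 + 0 ·j) ∷ closing (1 + 0 ·j) (8 + 4 ·j) ∷ closing (4 + 2 ·j) (1 + 0 ·j) ∷ []

skolem-4j+9 : ∀ j → IsSkolemSequence (9 + 4 * j) (label j word-4j+9)
skolem-4j+9 j = word⇒skolemSequence j word-4j+9 (9 + 4 ·j) refl
  (mirror (# 1) (# 2) refl refl refl ∷ mirror (# 3) (# 6) refl refl refl ∷ mirror (# 5) (# 8) refl refl refl ∷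
   mirror (# 0) (# 7) refl refl refl ∷ mirror (# 4) (# 10) refl refl refl ∷ [])
  (mirror (# 9) (# 11) refl refl refl ∷ [])
  (n≤1+n _) ≤-refl

mod4⇒skolemCircle : ∀ m → 2 ≤ m → m % 4 ≡ 0 ⊎ m % 4 ≡ 1 → SkolemCircleExists m
mod4⇒skolemCircle m 2≤m m%4≡0,1 with m % 4 | m / 4 | m≡m%n+[m/n]*n m 4
... | 0 | 0 | refl with () ← 2≤m
... | 1 | 0 | refl with s≤s () ← 2≤m
... | 0 | 1 | refl = skolemSequence⇒circle (label 0 word-4) skolem-4
... | 1 | 1 | refl = skolemSequence⇒circle (label 0 word-5) skolem-5
... | 0 | suc (suc j) | refl =
  subst (λ x → SkolemCircleExists (8 + x)) (*-comm 4 j) (skolemSequence⇒circle (label j word-4j+8) (skolem-4j+8 j))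
... | 1 | suc (suc j) | refl =
  subst (λ x → SkolemCircleExists (9 + x)) (*-comm 4 j) (skolemSequence⇒circle (label j word-4j+9) (skolem-4j+9 j))
... | suc (suc _) | _ | _ with m%4≡0,1
... | inj₁ ()
... | inj₂ ()

theorem2 : (m : ℕ) → 2 ≤ m → SkolemCircleExists m ⇔ (m % 4 ≡ 0 ⊎ m % 4 ≡ 1)
theorem2 m 2≤m = mk⇔ (λ (f , circle) → skolemCircle⇒mod4 f circle) (mod4⇒skolemCircle m 2≤m)
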